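{- Define polynomials $P_w, Q_w\in\mathbb{Z}[z]$ by $P_0=1,\ Q_0=1$; $P_1=1,\ Q_1=1-z$; $P_2=1-z,\ Q_2=1-2z-3z^2$; $P_3=1-2z-3z^2,\ Q_3=1-3z-5z^2-2z^3+z^4$; $P_4=1-3z-5z^2-2z^3+z^4,\ Q_4=1-4z-6z^2+2z^3$; and for $w\ge 5$, $$P_w=Q_{w-1},\qquad Q_w=(1+z)Q_{w-1}-2zQ_{w-2}-2z^2Q_{w-3}+(z^3+z^4)Q_{w-4}-z^5Q_{w-5}.$$ For an integer $w\ge0$ let $F_w(z)=\sum_{n\ge0}a_{w,n}z^n$, where $a_{w,n}$ is the number of lattice walks with steps $(1,1)$, $(1,-1)$, $(2,2)$, $(2,-2)$ from $(0,0)$ to $(2n,0)$ that never leave the strip $0\le y\le w$ (with $a_{w,0}=1$ for the empty walk). Then for every $w\ge 0$, $F_w = P_w/Q_w$ (as formal power series in $z$).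
   Context: In the paper the denominator polynomials $Q_w$ are denoted by a special symbol ("AZ$_w$"); here they are written $Q_w$. -}

module Defs where

open import Data.Nat as ℕ using (ℕ; zero; suc)
open import Data.Integer as ℤ using (ℤ; +_; -_)
open import Data.Bool using (Bool; true; false; _∧_)
open import Data.List using (List; []; _∷_; map; _++_; length; filter)
open import Relation.Nullary.Decidable using (⌊_⌋; T?)

-- Polynomials in ℤ[z] as coefficient lists (constant term first)

Poly : Set
Poly = List ℤ

coeff : Poly → ℕ → ℤ
coeff []       _       = + 0
coeff (a ∷ p)  zero    = a
coeff (a ∷ p)  (suc n) = coeff p n

infixl 6 _⊕_
infixl 7 _⊗_ _·_

_⊕_ : Poly → Poly → Poly
[]      ⊕ q       = q
p       ⊕ []      = p
(a ∷ p) ⊕ (b ∷ q) = (a ℤ.+ b) ∷ (p ⊕ q)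

_·_ : ℤ → Poly → Poly
c · p = map (c ℤ.*_) p

_⊗_ : Poly → Poly → Poly
[]      ⊗ q = []
(a ∷ p) ⊗ q = a · q ⊕ (+ 0 ∷ p ⊗ q)

z : Poly
z = + 0 ∷ + 1 ∷ []

one : Poly
one = + 1 ∷ []

zp : ℕ → Poly
zp zero    = one
zp (suc k) = z ⊗ zp k

Q : ℕ → Poly
Q 0 = + 1 ∷ []
Q 1 = + 1 ∷ - (+ 1) ∷ []
Q 2 = + 1 ∷ - (+ 2) ∷ - (+ 3) ∷ []
Q 3 = + 1 ∷ - (+ 3) ∷ - (+ 5) ∷ - (+ 2) ∷ + 1 ∷ []
Q 4 = + 1 ∷ - (+ 4) ∷ - (+ 6) ∷ + 2 ∷ []
Q (suc (suc (suc (suc (suc w))))) =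
      (one ⊕ z) ⊗ Q (suc (suc (suc (suc w))))
    ⊕ (- (+ 2)) · (z ⊗ Q (suc (suc (suc w))))
    ⊕ (- (+ 2)) · (zp 2 ⊗ Q (suc (suc w)))
    ⊕ (zp 3 ⊕ zp 4) ⊗ Q (suc w)
    ⊕ (- (+ 1)) · (zp 5 ⊗ Q w)

P : ℕ → Poly
P 0 = + 1 ∷ []
P 1 = + 1 ∷ []
P 2 = + 1 ∷ - (+ 1) ∷ []
P 3 = + 1 ∷ - (+ 2) ∷ - (+ 3) ∷ []
P 4 = + 1 ∷ - (+ 3) ∷ - (+ 5) ∷ - (+ 2) ∷ + 1 ∷ []
P (suc w@(suc (suc (suc (suc _))))) = Q w

data Step : Set where
  u1 d1 u2 d2 : Step

dy : Step → ℤ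
dy u1 = + 1
dy d1 = - (+ 1)
dy u2 = + 2
dy d2 = - (+ 2)

-- all step sequences whose total horizontal displacement is exactly L
stepSeqs : ℕ → List (List Step)
stepSeqs zero = [] ∷ []
stepSeqs (suc zero) = map (u1 ∷_) (stepSeqs zero) ++ map (d1 ∷_) (stepSeqs zero)
stepSeqs (suc (suc L)) =
     map (u1 ∷_) (stepSeqs (suc L)) ++ map (d1 ∷_) (stepSeqs (suc L))
  ++ map (u2 ∷_) (stepSeqs L)      ++ map (d2 ∷_) (stepSeqs L)

-- starting at height y (assumed within the strip), the walk stays in
-- 0 ≤ y ≤ w at every vertex and ends at height 0
valid : ℕ → ℤ → List Step → Bool
valid w y []       = ⌊ y ℤ.≟ + 0 ⌋
valid w y (s ∷ ss) =
  ⌊ + 0 ℤ.≤? (y ℤ.+ dy s) ⌋ ∧ ⌊ (y ℤ.+ dy s) ℤ.≤? + w ⌋ ∧ valid w (y ℤ.+ dy s) ss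

a : ℕ → ℕ → ℕ
a w n = length (filter (λ ss → T? (valid w (+ 0) ss)) (stepSeqs (2 ℕ.* n)))

convAux : Poly → (ℕ → ℤ) → ℕ → ℕ → ℤ
convAux p f n zero    = coeff p 0 ℤ.* f n
convAux p f n (suc k) = coeff p (suc k) ℤ.* f (n ℕ.∸ suc k) ℤ.+ convAux p f n k

mulCoeff : Poly → (ℕ → ℤ) → ℕ → ℤ
mulCoeff p f n = convAux p f n n

F : ℕ → ℕ → ℤ
F w n = + (a w n)

-- Let K y be the series of walks that start at height y of the strip, with zⁿ marking length
-- 2n + y, so that F w = K 0.  Splitting off the first step gives the linear system
-- transfer K = δ, and the operator transfer is symmetric for the pairing
-- ⟨ f , g ⟩ = Σ_y z^y f y g y on sequences vanishing above w.  Pairing the system with a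
-- solution U of the homogeneous equation that vanishes above w gives U 0 = (transfer U) 0 · K 0.
-- Building U from two fundamental solutions α, β of the four-term recurrence, U 0 and
-- (transfer U) 0 become the signed Casoratians D w and D (w + 1); these satisfy the
-- five-term recurrence of Q with matching initial values, so P w = D w and Q w = D (w + 1).

module Submission where

open import Defs
open import Data.Nat as ℕ using (ℕ; zero; suc; s≤s)
open import Data.Integer as ℤ using (ℤ; +_)
import Data.Integer.Properties as ℤP
import Data.Nat.Properties as ℕP
open import Data.Integer.Tactic.RingSolver using (solve-∀)
open import Data.List using (List; []; _∷_; _++_; map; length; filter)
open import Data.List.Properties using (filter-++; length-++)
open import Data.Bool using (Bool; true; false; _∧_; if_then_else_)
open import Relation.Nullary.Decidable using (Dec; ⌊_⌋; T?; isYes≗does; dec-true; dec-false)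
open import Data.Vec using ([]; _∷_)
import Data.Fin as Fin
open import Data.Maybe using (Maybe; just; nothing)
open import Data.Product using (_×_; _,_; proj₁)
open import Data.Sum using (_⊎_; inj₁; inj₂)
open import Level using (0ℓ)
open import Relation.Nullary using (¬_; yes; no)
open import Relation.Binary.PropositionalEquality
  using (_≡_; refl; cong; cong₂; sym; trans; subst; module ≡-Reasoning)
open import Algebra.Bundles using (CommutativeRing; Semiring; RawRing)
open import Algebra.Structures using (IsAbelianGroup; IsCommutativeRing)
import Algebra.Construct.Pointwise as Pointwise
import Relation.Binary.Reasoning.Setoid
import Algebra.Solver.Ring.AlmostCommutativeRing as ACR
open import Algebra.Properties.CommutativeSemigroup ℤP.+-commutativeSemigroup using (x∙yz≈y∙xz)

-- Over an arbitrary raw ring, so that D can be evaluated on series and on solver expressions alike.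
module Casoratian (R : RawRing 0ℓ 0ℓ) (z : RawRing.Carrier R) where
  open RawRing R
  open import Algebra.Definitions.RawSemiring rawSemiring using (_^_)

  infixl 6 _-_
  _-_ : Carrier → Carrier → Carrier
  x - y = x + - y

  module _ (v₀ v₁ v₂ v₃ : Carrier) where
    recSeq : ℕ → Carrier
    recSeq 0 = v₀
    recSeq 1 = v₁
    recSeq 2 = v₂
    recSeq 3 = v₃
    recSeq (suc (suc (suc (suc k)))) =
      recSeq (suc (suc k)) - recSeq (suc (suc (suc k))) - z * recSeq (suc k) - z ^ 2 * recSeq k

  α β : ℕ → Carrier
  α = recSeq 0# 0# 1# 0#
  β = recSeq 0# 0# 0# 1#

  sign : ℕ → Carrier
  sign zero    = 1#
  sign (suc k) = - sign k

  D : ℕ → Carrier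
  D k = sign k * (α (2 ℕ.+ k) * β (3 ℕ.+ k) - α (3 ℕ.+ k) * β (2 ℕ.+ k))

-- Formal power series ℤ[[z]]

Series : Set
Series = ℕ → ℤ

infix 4 _≈_
_≈_ : Series → Series → Set
f ≈ g = ∀ n → f n ≡ g n

infixl 6 _+_
infixl 7 _*_
infix 8 -_

_+_ : Series → Series → Series
(f + g) n = f n ℤ.+ g n

-_ : Series → Series
(- f) n = ℤ.- f n

infixl 6 _-_
_-_ : Series → Series → Series
f - g = f + - g

const : ℤ → Series
const c zero    = c
const c (suc _) = + 0

-- Defined as const (+ 0), the solver's reading of con (+ 0), so that both evaluations of D agree.
0# : Series
0# = const (+ 0)

1# : Series
1# = const (+ 1)

tail : Series → Series
tail f n = f (suc n)

scale : ℤ → Series → Series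
scale c f n = c ℤ.* f n

_*_ : Series → Series → Series
(f * g) zero    = f 0 ℤ.* g 0
(f * g) (suc n) = f 0 ℤ.* g (suc n) ℤ.+ (tail f * g) n

*-congˡ : ∀ {f f′} g → f ≈ f′ → f * g ≈ f′ * g
*-congˡ g f≈f′ zero    = cong (ℤ._* g 0) (f≈f′ 0)
*-congˡ g f≈f′ (suc n) =
  cong₂ ℤ._+_ (cong (ℤ._* g (suc n)) (f≈f′ 0)) (*-congˡ g (λ k → f≈f′ (suc k)) n)

*-congʳ : ∀ f {g g′} → g ≈ g′ → f * g ≈ f * g′
*-congʳ f g≈g′ zero    = cong (f 0 ℤ.*_) (g≈g′ 0)
*-congʳ f g≈g′ (suc n) = cong₂ ℤ._+_ (cong (f 0 ℤ.*_) (g≈g′ (suc n))) (*-congʳ (tail f) g≈g′ n)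

*-distribʳ-+ : ∀ h f g → (f + g) * h ≈ f * h + g * h
*-distribʳ-+ h f g zero    = ℤP.*-distribʳ-+ (h 0) (f 0) (g 0)
*-distribʳ-+ h f g (suc n) = begin
  (f 0 ℤ.+ g 0) ℤ.* h (suc n) ℤ.+ ((tail f + tail g) * h) n
    ≡⟨ cong (ℤ._+_ ((f 0 ℤ.+ g 0) ℤ.* h (suc n))) (*-distribʳ-+ h (tail f) (tail g) n) ⟩
  (f 0 ℤ.+ g 0) ℤ.* h (suc n) ℤ.+ ((tail f * h) n ℤ.+ (tail g * h) n)
    ≡⟨ regroup (f 0) (g 0) (h (suc n)) ((tail f * h) n) ((tail g * h) n) ⟩
  (f * h + g * h) (suc n) ∎
  where
  open ≡-Reasoning
  regroup : ∀ a b c x y → (a ℤ.+ b) ℤ.* c ℤ.+ (x ℤ.+ y) ≡ (a ℤ.* c ℤ.+ x) ℤ.+ (b ℤ.* c ℤ.+ y)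
  regroup = solve-∀

*-distribˡ-+ : ∀ f g h → f * (g + h) ≈ f * g + f * h
*-distribˡ-+ f g h zero    = ℤP.*-distribˡ-+ (f 0) (g 0) (h 0)
*-distribˡ-+ f g h (suc n) = begin
  f 0 ℤ.* (g (suc n) ℤ.+ h (suc n)) ℤ.+ (tail f * (g + h)) n
    ≡⟨ cong (ℤ._+_ (f 0 ℤ.* (g (suc n) ℤ.+ h (suc n)))) (*-distribˡ-+ (tail f) g h n) ⟩
  f 0 ℤ.* (g (suc n) ℤ.+ h (suc n)) ℤ.+ ((tail f * g) n ℤ.+ (tail f * h) n)
    ≡⟨ regroup (f 0) (g (suc n)) (h (suc n)) _ _ ⟩
  (f * g + f * h) (suc n) ∎
  where
  open ≡-Reasoning
  regroup : ∀ a b c x y → a ℤ.* (b ℤ.+ c) ℤ.+ (x ℤ.+ y) ≡ (a ℤ.* b ℤ.+ x) ℤ.+ (a ℤ.* c ℤ.+ y)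
  regroup = solve-∀

scale-*ˡ : ∀ c f g → scale c f * g ≈ scale c (f * g)
scale-*ˡ c f g zero    = ℤP.*-assoc c (f 0) (g 0)
scale-*ˡ c f g (suc n) = begin
  c ℤ.* f 0 ℤ.* g (suc n) ℤ.+ (scale c (tail f) * g) n
    ≡⟨ cong (ℤ._+_ (c ℤ.* f 0 ℤ.* g (suc n))) (scale-*ˡ c (tail f) g n) ⟩
  c ℤ.* f 0 ℤ.* g (suc n) ℤ.+ c ℤ.* (tail f * g) n
    ≡⟨ factor c (f 0) (g (suc n)) _ ⟩
  c ℤ.* (f 0 ℤ.* g (suc n) ℤ.+ (tail f * g) n) ∎
  where
  open ≡-Reasoning
  factor : ∀ a b c x → a ℤ.* b ℤ.* c ℤ.+ a ℤ.* x ≡ a ℤ.* (b ℤ.* c ℤ.+ x)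
  factor = solve-∀

-- The defining recursion peels off f 0; this is the one peeling off g 0.
*-suc-unfoldʳ : ∀ f g n → (f * g) (suc n) ≡ f (suc n) ℤ.* g 0 ℤ.+ (f * tail g) n
*-suc-unfoldʳ f g zero    = ℤP.+-comm (f 0 ℤ.* g 1) (f 1 ℤ.* g 0)
*-suc-unfoldʳ f g (suc n) = begin
  f 0 ℤ.* g (2 ℕ.+ n) ℤ.+ (tail f * g) (suc n)
    ≡⟨ cong (ℤ._+_ (f 0 ℤ.* g (2 ℕ.+ n))) (*-suc-unfoldʳ (tail f) g n) ⟩
  f 0 ℤ.* g (2 ℕ.+ n) ℤ.+ (f (2 ℕ.+ n) ℤ.* g 0 ℤ.+ (tail f * tail g) n)
    ≡⟨ x∙yz≈y∙xz (f 0 ℤ.* g (2 ℕ.+ n)) (f (2 ℕ.+ n) ℤ.* g 0) ((tail f * tail g) n) ⟩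
  f (2 ℕ.+ n) ℤ.* g 0 ℤ.+ (f * tail g) (suc n) ∎
  where open ≡-Reasoning

*-comm : ∀ f g → f * g ≈ g * f
*-comm f g zero    = ℤP.*-comm (f 0) (g 0)
*-comm f g (suc n) = trans (cong₂ ℤ._+_ (ℤP.*-comm (f 0) (g (suc n))) (*-comm (tail f) g n))
                           (sym (*-suc-unfoldʳ g f n))

*-assoc : ∀ f g h → (f * g) * h ≈ f * (g * h)
*-assoc f g h zero    = ℤP.*-assoc (f 0) (g 0) (h 0)
*-assoc f g h (suc n) = begin
  f 0 ℤ.* g 0 ℤ.* h (suc n) ℤ.+ ((scale (f 0) (tail g) + tail f * g) * h) n
    ≡⟨ cong (ℤ._+_ (f 0 ℤ.* g 0 ℤ.* h (suc n))) (*-distribʳ-+ h (scale (f 0) (tail g)) (tail f * g) n) ⟩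
  f 0 ℤ.* g 0 ℤ.* h (suc n) ℤ.+ ((scale (f 0) (tail g) * h) n ℤ.+ ((tail f * g) * h) n)
    ≡⟨ cong (ℤ._+_ (f 0 ℤ.* g 0 ℤ.* h (suc n))) (cong₂ ℤ._+_ (scale-*ˡ (f 0) (tail g) h n) (*-assoc (tail f) g h n)) ⟩
  f 0 ℤ.* g 0 ℤ.* h (suc n) ℤ.+ (f 0 ℤ.* (tail g * h) n ℤ.+ (tail f * (g * h)) n)
    ≡⟨ regroup (f 0) (g 0) (h (suc n)) ((tail g * h) n) ((tail f * (g * h)) n) ⟩
  (f * (g * h)) (suc n) ∎
  where
  open ≡-Reasoning
  regroup : ∀ a b c d e → a ℤ.* b ℤ.* c ℤ.+ (a ℤ.* d ℤ.+ e) ≡ a ℤ.* (b ℤ.* c ℤ.+ d) ℤ.+ e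
  regroup = solve-∀

0#-≡ : ∀ n → 0# n ≡ + 0
0#-≡ zero    = refl
0#-≡ (suc n) = refl

*-vanishˡ : ∀ {f} g → (∀ n → f n ≡ + 0) → ∀ n → (f * g) n ≡ + 0
*-vanishˡ g f≡0 zero    = trans (cong (ℤ._* g 0) (f≡0 0)) (ℤP.*-zeroˡ (g 0))
*-vanishˡ g f≡0 (suc n) = cong₂ ℤ._+_ (trans (cong (ℤ._* g (suc n)) (f≡0 0)) (ℤP.*-zeroˡ (g (suc n))))
                                      (*-vanishˡ g (λ k → f≡0 (suc k)) n)

*-identityˡ : ∀ f → 1# * f ≈ f
*-identityˡ f zero    = ℤP.*-identityˡ (f 0)
*-identityˡ f (suc n) = begin
  + 1 ℤ.* f (suc n) ℤ.+ (tail 1# * f) n ≡⟨ cong (ℤ._+_ (+ 1 ℤ.* f (suc n))) (*-vanishˡ f (λ _ → refl) n) ⟩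
  + 1 ℤ.* f (suc n) ℤ.+ + 0             ≡⟨ ℤP.+-identityʳ _ ⟩
  + 1 ℤ.* f (suc n)                     ≡⟨ ℤP.*-identityˡ _ ⟩
  f (suc n)                             ∎
  where open ≡-Reasoning

+-isAbelianGroup : IsAbelianGroup _≈_ _+_ 0# (-_)
+-isAbelianGroup = record
  { isGroup = record
    { isMonoid = record
      { isSemigroup = Pointwise.isSemigroup ℕ ℤP.+-isSemigroup
      ; identity    = (λ f n → trans (cong (ℤ._+ f n) (0#-≡ n)) (ℤP.+-identityˡ (f n)))
                    , (λ f n → trans (cong (ℤ._+_ (f n)) (0#-≡ n)) (ℤP.+-identityʳ (f n)))
      }
    ; inverse = (λ f n → trans (ℤP.+-inverseˡ (f n)) (sym (0#-≡ n)))
              , (λ f n → trans (ℤP.+-inverseʳ (f n)) (sym (0#-≡ n)))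
    ; ⁻¹-cong = λ f≈g n → cong ℤ.-_ (f≈g n)
    }
  ; comm = λ f g n → ℤP.+-comm (f n) (g n)
  }

isCommutativeRing : IsCommutativeRing _≈_ _+_ _*_ (-_) 0# 1#
isCommutativeRing = record
  { isRing = record
    { +-isAbelianGroup = +-isAbelianGroup
    ; *-cong           = λ {f} {f′} {g} {g′} f≈f′ g≈g′ n → trans (*-congˡ g f≈f′ n) (*-congʳ f′ g≈g′ n)
    ; *-assoc          = *-assoc
    ; *-identity       = *-identityˡ , λ f n → trans (*-comm f 1# n) (*-identityˡ f n)
    ; distrib          = *-distribˡ-+ , λ h f g → *-distribʳ-+ h f g
    }
  ; *-comm = *-comm
  }

seriesRing : CommutativeRing 0ℓ 0ℓ
seriesRing = record { isCommutativeRing = isCommutativeRing }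

open CommutativeRing seriesRing public
  using (+-cong; *-cong; -‿cong) renaming (refl to ≈-refl; reflexive to ≈-reflexive; sym to ≈-sym; trans to ≈-trans)

+-congˡ : ∀ f {g g′} → g ≈ g′ → f + g ≈ f + g′
+-congˡ f g≈g′ n = cong (ℤ._+_ (f n)) (g≈g′ n)

+-congʳ : ∀ h {f f′} → f ≈ f′ → f + h ≈ f′ + h
+-congʳ h f≈f′ n = cong (ℤ._+ h n) (f≈f′ n)

module ≈-Reasoning = Relation.Binary.Reasoning.Setoid (CommutativeRing.setoid seriesRing)

open import Algebra.Definitions.RawSemiring (Semiring.rawSemiring (CommutativeRing.semiring seriesRing)) using (_^_)

const-* : ∀ a b → const (a ℤ.* b) ≈ const a * const b
const-* a b zero    = refl
const-* a b (suc n) = sym (cong₂ ℤ._+_ (ℤP.*-zeroʳ a) (*-vanishˡ (const b) (λ _ → refl) n))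

constMorphism : ℤ.+-*-rawRing ACR.-Raw-AlmostCommutative⟶ ACR.fromCommutativeRing seriesRing
constMorphism = record
  { ⟦_⟧    = const
  ; +-homo = λ { a b zero → refl ; a b (suc n) → refl }
  ; *-homo = const-*
  ; -‿homo = λ { a zero → refl ; a (suc n) → refl }
  ; 0-homo = λ _ → refl
  ; 1-homo = λ { zero → refl ; (suc n) → refl }
  }

const-≟ : ∀ a b → Maybe (const a ≈ const b)
const-≟ a b with a ℤ.≟ b
... | yes refl = just (λ _ → refl)
... | no _     = nothing

open import Algebra.Solver.Ring ℤ.+-*-rawRing (ACR.fromCommutativeRing seriesRing) constMorphism const-≟

-- Polynomials as power series

Z : Series
Z = coeff z

Z*-zero : ∀ f → (Z * f) 0 ≡ + 0
Z*-zero f = ℤP.*-zeroˡ (f 0)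

Z*-suc : ∀ f n → (Z * f) (suc n) ≡ f n
Z*-suc f n = begin
  + 0 ℤ.* f (suc n) ℤ.+ (tail Z * f) n ≡⟨ ℤP.+-identityˡ _ ⟩
  (tail Z * f) n                       ≡⟨ *-congˡ f tail-Z≈1 n ⟩
  (1# * f) n                           ≡⟨ *-identityˡ f n ⟩
  f n                                  ∎
  where
  open ≡-Reasoning
  tail-Z≈1 : tail Z ≈ 1#
  tail-Z≈1 zero    = refl
  tail-Z≈1 (suc n) = refl

coeff-⊕ : ∀ p q → coeff (p ⊕ q) ≈ coeff p + coeff q
coeff-⊕ []      q       n       = sym (ℤP.+-identityˡ (coeff q n))
coeff-⊕ (a ∷ p) []      n       = sym (ℤP.+-identityʳ (coeff (a ∷ p) n))
coeff-⊕ (a ∷ p) (b ∷ q) zero    = refl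
coeff-⊕ (a ∷ p) (b ∷ q) (suc n) = coeff-⊕ p q n

coeff-· : ∀ c p n → coeff (c · p) n ≡ c ℤ.* coeff p n
coeff-· c []      n       = sym (ℤP.*-zeroʳ c)
coeff-· c (a ∷ p) zero    = refl
coeff-· c (a ∷ p) (suc n) = coeff-· c p n

const-*-≈-scale : ∀ c f → const c * f ≈ scale c f
const-*-≈-scale c f zero    = refl
const-*-≈-scale c f (suc n) = begin
  c ℤ.* f (suc n) ℤ.+ (tail (const c) * f) n ≡⟨ cong (ℤ._+_ (c ℤ.* f (suc n))) (*-vanishˡ f (λ _ → refl) n) ⟩
  c ℤ.* f (suc n) ℤ.+ + 0                    ≡⟨ ℤP.+-identityʳ _ ⟩
  c ℤ.* f (suc n)                            ∎
  where open ≡-Reasoning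

coeff-⊗ : ∀ p q → coeff (p ⊗ q) ≈ coeff p * coeff q
coeff-⊗ []      q n       = sym (*-vanishˡ (coeff q) (λ _ → refl) n)
coeff-⊗ (a ∷ p) q zero    = begin
  coeff (a · q ⊕ (+ 0 ∷ p ⊗ q)) 0 ≡⟨ coeff-⊕ (a · q) (+ 0 ∷ p ⊗ q) 0 ⟩
  coeff (a · q) 0 ℤ.+ + 0         ≡⟨ ℤP.+-identityʳ _ ⟩
  coeff (a · q) 0                 ≡⟨ coeff-· a q 0 ⟩
  a ℤ.* coeff q 0                 ∎
  where open ≡-Reasoning
coeff-⊗ (a ∷ p) q (suc n) =
  trans (coeff-⊕ (a · q) (+ 0 ∷ p ⊗ q) (suc n)) (cong₂ ℤ._+_ (coeff-· a q (suc n)) (coeff-⊗ p q n))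

coeff-scale : ∀ c p → coeff (c · p) ≈ const c * coeff p
coeff-scale c p n = trans (coeff-· c p n) (sym (const-*-≈-scale c (coeff p) n))

coeff-one : coeff one ≈ 1#
coeff-one zero    = refl
coeff-one (suc n) = refl

coeff-zp : ∀ k → coeff (zp k) ≈ Z ^ k
coeff-zp zero    = coeff-one
coeff-zp (suc k) n = trans (coeff-⊗ z (zp k) n) (*-congʳ Z (coeff-zp k) n)

rec₅ : Series → Series → Series → Series → Series → Series
rec₅ q₀ q₁ q₂ q₃ q₄ =
    (1# + Z) * q₄
  + const (ℤ.- (+ 2)) * (Z * q₃)
  + const (ℤ.- (+ 2)) * (Z ^ 2 * q₂)
  + (Z ^ 3 + Z ^ 4) * q₁
  + const (ℤ.- (+ 1)) * (Z ^ 5 * q₀)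

rec₅-cong : ∀ {q₀ q₁ q₂ q₃ q₄ r₀ r₁ r₂ r₃ r₄} →
  q₀ ≈ r₀ → q₁ ≈ r₁ → q₂ ≈ r₂ → q₃ ≈ r₃ → q₄ ≈ r₄ → rec₅ q₀ q₁ q₂ q₃ q₄ ≈ rec₅ r₀ r₁ r₂ r₃ r₄
rec₅-cong e₀ e₁ e₂ e₃ e₄ =
  +-cong (+-cong (+-cong (+-cong (*-cong ≈-refl e₄) (*-cong ≈-refl (*-cong ≈-refl e₃)))
    (*-cong ≈-refl (*-cong ≈-refl e₂))) (*-cong ≈-refl e₁)) (*-cong ≈-refl (*-cong ≈-refl e₀))

coeff-Q-rec : ∀ w → coeff (Q (5 ℕ.+ w)) ≈
  rec₅ (coeff (Q w)) (coeff (Q (1 ℕ.+ w))) (coeff (Q (2 ℕ.+ w))) (coeff (Q (3 ℕ.+ w))) (coeff (Q (4 ℕ.+ w)))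
coeff-Q-rec w = ≈-trans split (+-cong (+-cong (+-cong (+-cong e₁ e₂) e₃) e₄) e₅)
  where
  q₀ q₁ q₂ q₃ q₄ t₁ t₂ t₃ t₄ t₅ : Poly
  q₀ = Q w ; q₁ = Q (1 ℕ.+ w) ; q₂ = Q (2 ℕ.+ w) ; q₃ = Q (3 ℕ.+ w) ; q₄ = Q (4 ℕ.+ w)
  t₁ = (one ⊕ z) ⊗ q₄
  t₂ = ℤ.- (+ 2) · (z ⊗ q₃)
  t₃ = ℤ.- (+ 2) · (zp 2 ⊗ q₂)
  t₄ = (zp 3 ⊕ zp 4) ⊗ q₁
  t₅ = ℤ.- (+ 1) · (zp 5 ⊗ q₀)

  split : coeff (t₁ ⊕ t₂ ⊕ t₃ ⊕ t₄ ⊕ t₅) ≈ coeff t₁ + coeff t₂ + coeff t₃ + coeff t₄ + coeff t₅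
  split = ≈-trans (coeff-⊕ (t₁ ⊕ t₂ ⊕ t₃ ⊕ t₄) t₅) (+-cong
          (≈-trans (coeff-⊕ (t₁ ⊕ t₂ ⊕ t₃) t₄) (+-cong
          (≈-trans (coeff-⊕ (t₁ ⊕ t₂) t₃) (+-cong (coeff-⊕ t₁ t₂) ≈-refl)) ≈-refl)) ≈-refl)

  e₁ : coeff t₁ ≈ (1# + Z) * coeff q₄
  e₁ = ≈-trans (coeff-⊗ (one ⊕ z) q₄) (*-cong (≈-trans (coeff-⊕ one z) (+-cong coeff-one ≈-refl)) ≈-refl)

  e₂ : coeff t₂ ≈ const (ℤ.- (+ 2)) * (Z * coeff q₃)
  e₂ = ≈-trans (coeff-scale _ (z ⊗ q₃)) (*-cong ≈-refl (coeff-⊗ z q₃))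

  e₃ : coeff t₃ ≈ const (ℤ.- (+ 2)) * (Z ^ 2 * coeff q₂)
  e₃ = ≈-trans (coeff-scale _ (zp 2 ⊗ q₂)) (*-cong ≈-refl (≈-trans (coeff-⊗ (zp 2) q₂) (*-cong (coeff-zp 2) ≈-refl)))

  e₄ : coeff t₄ ≈ (Z ^ 3 + Z ^ 4) * coeff q₁
  e₄ = ≈-trans (coeff-⊗ (zp 3 ⊕ zp 4) q₁) (*-cong (≈-trans (coeff-⊕ (zp 3) (zp 4)) (+-cong (coeff-zp 3) (coeff-zp 4))) ≈-refl)

  e₅ : coeff t₅ ≈ const (ℤ.- (+ 1)) * (Z ^ 5 * coeff q₀)
  e₅ = ≈-trans (coeff-scale _ (zp 5 ⊗ q₀)) (*-cong ≈-refl (≈-trans (coeff-⊗ (zp 5) q₀) (*-cong (coeff-zp 5) ≈-refl)))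

-- P and Q as signed Casoratians

open Casoratian (CommutativeRing.rawRing seriesRing) Z using (α; β; sign; D)

D-rec : ∀ k → D (5 ℕ.+ k) ≈ rec₅ (D k) (D (1 ℕ.+ k)) (D (2 ℕ.+ k)) (D (3 ℕ.+ k)) (D (4 ℕ.+ k))
D-rec k = solve 10 (λ s z a₀ a₁ a₂ a₃ b₀ b₁ b₂ b₃ →
    let next = λ x₀ x₁ x₂ x₃ → x₂ :- x₃ :- z :* x₁ :- z :^ 2 :* x₀
        a₄ = next a₀ a₁ a₂ a₃ ; a₅ = next a₁ a₂ a₃ a₄ ; a₆ = next a₂ a₃ a₄ a₅
        b₄ = next b₀ b₁ b₂ b₃ ; b₅ = next b₁ b₂ b₃ b₄ ; b₆ = next b₂ b₃ b₄ b₅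
        d = λ σ x₀ x₁ y₀ y₁ → σ :* (x₀ :* y₁ :- x₁ :* y₀)
        s₁ = :- s ; s₂ = :- s₁ ; s₃ = :- s₂ ; s₄ = :- s₃ ; s₅ = :- s₄
    in d s₅ a₅ a₆ b₅ b₆ :=
         (con (+ 1) :+ z) :* d s₄ a₄ a₅ b₄ b₅
      :+ con (ℤ.- (+ 2)) :* (z :* d s₃ a₃ a₄ b₃ b₄)
      :+ con (ℤ.- (+ 2)) :* (z :^ 2 :* d s₂ a₂ a₃ b₂ b₃)
      :+ (z :^ 3 :+ z :^ 4) :* d s₁ a₁ a₂ b₁ b₂
      :+ con (ℤ.- (+ 1)) :* (z :^ 5 :* d s a₀ a₁ b₀ b₁))
  (λ _ → refl) (sign k) Z (α (2 ℕ.+ k)) (α (3 ℕ.+ k)) (α (4 ℕ.+ k)) (α (5 ℕ.+ k))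
                          (β (2 ℕ.+ k)) (β (3 ℕ.+ k)) (β (4 ℕ.+ k)) (β (5 ℕ.+ k))

polynomialRing : ℕ → RawRing 0ℓ 0ℓ
polynomialRing m = record
  { Carrier = Polynomial m ; _≈_ = _≡_ ; _+_ = _:+_ ; _*_ = _:*_ ; -_ = :-_
  ; 0# = con (+ 0) ; 1# = con (+ 1) }

horner : ∀ {m} → Polynomial m → Poly → Polynomial m
horner x []      = con (+ 0)
horner x (c ∷ p) = con c :+ x :* horner x p

evalHorner : Poly → Series
evalHorner p = ⟦ horner (var Fin.zero) p ⟧ (Z ∷ [])

coeff-horner : ∀ p → coeff p ≈ evalHorner p
coeff-horner []      n       = sym (0#-≡ n)
coeff-horner (c ∷ p) zero    = sym (trans (cong (ℤ._+_ c) (Z*-zero (evalHorner p))) (ℤP.+-identityʳ c))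
coeff-horner (c ∷ p) (suc n) =
  sym (trans (ℤP.+-identityˡ _) (trans (Z*-suc (evalHorner p) n) (sym (coeff-horner p n))))

symbolicD : Polynomial 1 → ℕ → Polynomial 1
symbolicD x = Casoratian.D (polynomialRing 1) x

via-horner : ∀ p k → evalHorner p ≈ D k → coeff p ≈ D k
via-horner p k = ≈-trans (coeff-horner p)

P0≈D0 : coeff (P 0) ≈ D 0
P0≈D0 = via-horner (P 0) 0 (solve 1 (λ x → horner x (P 0) := symbolicD x 0) (λ _ → refl) Z)

Q≈D-initial : (coeff (Q 0) ≈ D 1) × (coeff (Q 1) ≈ D 2) × (coeff (Q 2) ≈ D 3)
            × (coeff (Q 3) ≈ D 4) × (coeff (Q 4) ≈ D 5)
Q≈D-initial =
    via-horner (Q 0) 1 (solve 1 (λ x → horner x (Q 0) := symbolicD x 1) (λ _ → refl) Z)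
  , via-horner (Q 1) 2 (solve 1 (λ x → horner x (Q 1) := symbolicD x 2) (λ _ → refl) Z)
  , via-horner (Q 2) 3 (solve 1 (λ x → horner x (Q 2) := symbolicD x 3) (λ _ → refl) Z)
  , via-horner (Q 3) 4 (solve 1 (λ x → horner x (Q 3) := symbolicD x 4) (λ _ → refl) Z)
  , via-horner (Q 4) 5 (solve 1 (λ x → horner x (Q 4) := symbolicD x 5) (λ _ → refl) Z)

Q≈D-window : ∀ w → (coeff (Q w) ≈ D (1 ℕ.+ w)) × (coeff (Q (1 ℕ.+ w)) ≈ D (2 ℕ.+ w))
  × (coeff (Q (2 ℕ.+ w)) ≈ D (3 ℕ.+ w)) × (coeff (Q (3 ℕ.+ w)) ≈ D (4 ℕ.+ w))
  × (coeff (Q (4 ℕ.+ w)) ≈ D (5 ℕ.+ w))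
Q≈D-window zero = Q≈D-initial
Q≈D-window (suc w) with Q≈D-window w
... | e₀ , e₁ , e₂ , e₃ , e₄ =
  e₁ , e₂ , e₃ , e₄ , ≈-trans (coeff-Q-rec w) (≈-trans (rec₅-cong e₀ e₁ e₂ e₃ e₄) (≈-sym (D-rec (suc w))))

Q≈D : ∀ w → coeff (Q w) ≈ D (suc w)
Q≈D w = proj₁ (Q≈D-window w)

P≈D : ∀ w → coeff (P w) ≈ D w
P≈D zero                            = P0≈D0
P≈D (suc zero)                      = Q≈D 0
P≈D (suc (suc zero))                = Q≈D 1
P≈D (suc (suc (suc zero)))          = Q≈D 2
P≈D (suc (suc (suc (suc zero))))    = Q≈D 3
P≈D (suc (suc (suc (suc (suc w))))) = Q≈D (4 ℕ.+ w)

-- Sums and the weighted pairing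

Σ< : ℕ → (ℕ → Series) → Series
Σ< zero    h = 0#
Σ< (suc N) h = h 0 + Σ< N (λ y → h (suc y))

Σ<-cong : ∀ N {h h′} → (∀ y → h y ≈ h′ y) → Σ< N h ≈ Σ< N h′
Σ<-cong zero    e = ≈-refl
Σ<-cong (suc N) e = +-cong (e 0) (Σ<-cong N (λ y → e (suc y)))

Σ<-distrib-− : ∀ N h h′ → Σ< N (λ y → h y - h′ y) ≈ Σ< N h - Σ< N h′
Σ<-distrib-− zero    h h′ = solve 0 (con (+ 0) := con (+ 0) :- con (+ 0)) (λ _ → refl)
Σ<-distrib-− (suc N) h h′ = ≈-trans (+-congˡ (h 0 - h′ 0) (Σ<-distrib-− N (λ y → h (suc y)) (λ y → h′ (suc y))))
  (solve 4 (λ a a′ b b′ → (a :- a′) :+ (b :- b′) := (a :+ b) :- (a′ :+ b′)) (λ _ → refl)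
    (h 0) (h′ 0) (Σ< N (λ y → h (suc y))) (Σ< N (λ y → h′ (suc y))))

Σ<-last : ∀ N h → Σ< (suc N) h ≈ Σ< N h + h N
Σ<-last zero    h = solve 1 (λ a → a :+ con (+ 0) := con (+ 0) :+ a) (λ _ → refl) (h 0)
Σ<-last (suc N) h = ≈-trans (+-congˡ (h 0) (Σ<-last N (λ y → h (suc y))))
  (solve 3 (λ a b c → a :+ (b :+ c) := (a :+ b) :+ c) (λ _ → refl) (h 0) (Σ< N (λ y → h (suc y))) (h (suc N)))

Σ<-drop-last : ∀ N h → h N ≈ 0# → Σ< (suc N) h ≈ Σ< N h
Σ<-drop-last N h hN≈0 = ≈-trans (Σ<-last N h)
  (≈-trans (+-congˡ (Σ< N h) hN≈0) (solve 1 (λ a → a :+ con (+ 0) := a) (λ _ → refl) (Σ< N h)))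

Σ<-zero : ∀ N h → (∀ y → h y ≈ 0#) → Σ< N h ≈ 0#
Σ<-zero zero    h h≈0 = ≈-refl
Σ<-zero (suc N) h h≈0 = ≈-trans (+-cong (h≈0 0) (Σ<-zero N (λ y → h (suc y)) (λ y → h≈0 (suc y))))
  (solve 0 (con (+ 0) :+ con (+ 0) := con (+ 0)) (λ _ → refl))

Σ<-head : ∀ N h → (∀ y → h (suc y) ≈ 0#) → Σ< (suc N) h ≈ h 0
Σ<-head N h tail≈0 = ≈-trans (+-congˡ (h 0) (Σ<-zero N (λ y → h (suc y)) tail≈0))
  (solve 1 (λ a → a :+ con (+ 0) := a) (λ _ → refl) (h 0))

pairing : ℕ → (ℕ → Series) → (ℕ → Series) → Series
pairing N f g = Σ< N (λ y → Z ^ y * f y * g y)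

pairing-comm : ∀ N f g → pairing N f g ≈ pairing N g f
pairing-comm N f g = Σ<-cong N (λ y →
  solve 3 (λ p a b → p :* a :* b := p :* b :* a) (λ _ → refl) (Z ^ y) (f y) (g y))

pairing-distribˡ-− : ∀ N f g h → pairing N (λ y → f y - g y) h ≈ pairing N f h - pairing N g h
pairing-distribˡ-− N f g h = ≈-trans (Σ<-cong N (λ y →
  solve 4 (λ p a b c → p :* (a :- b) :* c := p :* a :* c :- p :* b :* c) (λ _ → refl) (Z ^ y) (f y) (g y) (h y)))
  (Σ<-distrib-− N (λ y → Z ^ y * f y * h y) (λ y → Z ^ y * g y * h y))

pairing-distribʳ-− : ∀ N f g h → pairing N f (λ y → g y - h y) ≈ pairing N f g - pairing N f h
pairing-distribʳ-− N f g h = ≈-trans (Σ<-cong N (λ y →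
  solve 4 (λ p a b c → p :* a :* (b :- c) := p :* a :* b :- p :* a :* c) (λ _ → refl) (Z ^ y) (f y) (g y) (h y)))
  (Σ<-distrib-− N (λ y → Z ^ y * f y * g y) (λ y → Z ^ y * f y * h y))

prev prev2 : (ℕ → Series) → ℕ → Series
prev f zero    = 0#
prev f (suc y) = f y
prev2 f zero          = 0#
prev2 f (suc zero)    = 0#
prev2 f (suc (suc y)) = f y

-- The weight Z ^ y makes the down-steps adjoint to the up-steps.
prev-adjoint : ∀ N f g → pairing (suc N) f (prev g) ≈ pairing N (λ y → Z * f (suc y)) g
prev-adjoint N f g = ≈-trans
  (+-cong (solve 2 (λ p a → p :* a :* con (+ 0) := con (+ 0)) (λ _ → refl) (Z ^ 0) (f 0))
          (Σ<-cong N (λ y → solve 4 (λ z p a b → z :* p :* a :* b := p :* (z :* a) :* b) (λ _ → refl)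
                                      Z (Z ^ y) (f (suc y)) (g y))))
  (solve 1 (λ a → con (+ 0) :+ a := a) (λ _ → refl) (pairing N (λ y → Z * f (suc y)) g))

prev2-adjoint : ∀ N f g → pairing (2 ℕ.+ N) f (prev2 g) ≈ pairing N (λ y → Z ^ 2 * f (2 ℕ.+ y)) g
prev2-adjoint N f g = ≈-trans
  (+-cong (solve 2 (λ p a → p :* a :* con (+ 0) := con (+ 0)) (λ _ → refl) (Z ^ 0) (f 0))
  (+-cong (solve 2 (λ p a → p :* a :* con (+ 0) := con (+ 0)) (λ _ → refl) (Z ^ 1) (f 1))
          (Σ<-cong N (λ y → solve 4 (λ z p a b → z :* (z :* p) :* a :* b := p :* (z :^ 2 :* a) :* b)
                                      (λ _ → refl) Z (Z ^ y) (f (2 ℕ.+ y)) (g y)))))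
  (solve 1 (λ a → con (+ 0) :+ (con (+ 0) :+ a) := a) (λ _ → refl) (pairing N (λ y → Z ^ 2 * f (2 ℕ.+ y)) g))

pairing-expandʳ : ∀ N f a b c d e →
  pairing N f (λ y → a y - b y - c y - d y - e y)
    ≈ pairing N f a - pairing N f b - pairing N f c - pairing N f d - pairing N f e
pairing-expandʳ N f a b c d e =
  ≈-trans (pairing-distribʳ-− N f (λ y → a y - b y - c y - d y) e)
  (+-congʳ (- pairing N f e) (≈-trans (pairing-distribʳ-− N f (λ y → a y - b y - c y) d)
  (+-congʳ (- pairing N f d) (≈-trans (pairing-distribʳ-− N f (λ y → a y - b y) c)
  (+-congʳ (- pairing N f c) (pairing-distribʳ-− N f a b))))))

pairing-expandˡ : ∀ N g a b c d e →
  pairing N (λ y → a y - b y - c y - d y - e y) g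
    ≈ pairing N a g - pairing N b g - pairing N c g - pairing N d g - pairing N e g
pairing-expandˡ N g a b c d e =
  ≈-trans (pairing-distribˡ-− N (λ y → a y - b y - c y - d y) e g)
  (+-congʳ (- pairing N e g) (≈-trans (pairing-distribˡ-− N (λ y → a y - b y - c y) d g)
  (+-congʳ (- pairing N d g) (≈-trans (pairing-distribˡ-− N (λ y → a y - b y) c g)
  (+-congʳ (- pairing N c g) (pairing-distribˡ-− N a b g))))))

-- transfer K = δ is the first-step decomposition of the walks.
transfer : (ℕ → Series) → ℕ → Series
transfer f y = f y - prev f y - prev2 f y - Z * f (suc y) - Z ^ 2 * f (2 ℕ.+ y)

VanishesAbove : ℕ → (ℕ → Series) → Set
VanishesAbove w f = ∀ y → w ℕ.< y → f y ≈ 0#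

*-zeroʳ-≈ : ∀ x {y} → y ≈ 0# → x * y ≈ 0#
*-zeroʳ-≈ x y≈0 = ≈-trans (*-cong ≈-refl y≈0) (solve 1 (λ a → a :* con (+ 0) := con (+ 0)) (λ _ → refl) x)

module _ (w : ℕ) where

  private
    N : ℕ
    N = 3 ℕ.+ w

  pairing-drop-last : ∀ f g → VanishesAbove w g → ∀ k → w ℕ.< k → pairing (suc k) f g ≈ pairing k f g
  pairing-drop-last f g g≈0 k w<k = Σ<-drop-last k (λ y → Z ^ y * f y * g y) (*-zeroʳ-≈ (Z ^ k * f k) (g≈0 k w<k))

  prev-adjoint-strip : ∀ f g → VanishesAbove w g → pairing N f (prev g) ≈ pairing N (λ y → Z * f (suc y)) g
  prev-adjoint-strip f g g≈0 = ≈-trans (prev-adjoint (2 ℕ.+ w) f g)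
    (≈-sym (pairing-drop-last (λ y → Z * f (suc y)) g g≈0 (2 ℕ.+ w) (ℕP.m≤n+m (suc w) 1)))

  prev2-adjoint-strip : ∀ f g → VanishesAbove w g → pairing N f (prev2 g) ≈ pairing N (λ y → Z ^ 2 * f (2 ℕ.+ y)) g
  prev2-adjoint-strip f g g≈0 = ≈-trans (prev2-adjoint (1 ℕ.+ w) f g)
    (≈-sym (≈-trans (pairing-drop-last (λ y → Z ^ 2 * f (2 ℕ.+ y)) g g≈0 (2 ℕ.+ w) (ℕP.m≤n+m (suc w) 1))
                    (pairing-drop-last (λ y → Z ^ 2 * f (2 ℕ.+ y)) g g≈0 (1 ℕ.+ w) (ℕP.n<1+n w))))

  transfer-symmetric : ∀ f g → VanishesAbove w f → VanishesAbove w g →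
    pairing N f (transfer g) ≈ pairing N (transfer f) g
  transfer-symmetric f g f≈0 g≈0 = begin
    pairing N f (transfer g)
      ≈⟨ pairing-expandʳ N f g (prev g) (prev2 g) (λ y → Z * g (suc y)) (λ y → Z ^ 2 * g (2 ℕ.+ y)) ⟩
    f⟨ g ⟩ - f⟨ prev g ⟩ - f⟨ prev2 g ⟩ - f⟨ (λ y → Z * g (suc y)) ⟩ - f⟨ (λ y → Z ^ 2 * g (2 ℕ.+ y)) ⟩
      ≈⟨ +-cong (+-cong (+-cong (+-congˡ f⟨ g ⟩ (-‿cong (prev-adjoint-strip f g g≈0)))
                                            (-‿cong (prev2-adjoint-strip f g g≈0)))
                                    (-‿cong (moved (prev f) (λ y → Z * g (suc y)) (prev-adjoint-strip g f f≈0))))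
                            (-‿cong (moved (prev2 f) (λ y → Z ^ 2 * g (2 ℕ.+ y)) (prev2-adjoint-strip g f f≈0))) ⟩
    f⟨ g ⟩ - ⟨ Zf₁ ⟩g - ⟨ Zf₂ ⟩g - ⟨ prev f ⟩g - ⟨ prev2 f ⟩g
      ≈⟨ solve 5 (λ a b c d e → a :- b :- c :- d :- e := a :- d :- e :- b :- c) (λ _ → refl)
           f⟨ g ⟩ ⟨ Zf₁ ⟩g ⟨ Zf₂ ⟩g ⟨ prev f ⟩g ⟨ prev2 f ⟩g ⟩
    f⟨ g ⟩ - ⟨ prev f ⟩g - ⟨ prev2 f ⟩g - ⟨ Zf₁ ⟩g - ⟨ Zf₂ ⟩g
      ≈⟨ ≈-sym (pairing-expandˡ N g f (prev f) (prev2 f) Zf₁ Zf₂) ⟩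
    pairing N (transfer f) g ∎
    where
    open ≈-Reasoning
    f⟨_⟩ ⟨_⟩g : (ℕ → Series) → Series
    f⟨ h ⟩ = pairing N f h
    ⟨ h ⟩g = pairing N h g
    Zf₁ Zf₂ : ℕ → Series
    Zf₁ y = Z * f (suc y)
    Zf₂ y = Z ^ 2 * f (2 ℕ.+ y)
    moved : ∀ h h′ → pairing N g h ≈ pairing N h′ f → f⟨ h′ ⟩ ≈ ⟨ h ⟩g
    moved h h′ e = ≈-trans (pairing-comm N f h′) (≈-trans (≈-sym e) (pairing-comm N g h))

pairing-head : ∀ N f g → (∀ y → f (suc y) ≈ 0# ⊎ g (suc y) ≈ 0#) → pairing (suc N) f g ≈ f 0 * g 0
pairing-head N f g one-vanishes = ≈-trans (Σ<-head N (λ y → Z ^ y * f y * g y) term≈0)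
  (solve 2 (λ a b → con (+ 1) :* a :* b := a :* b) (λ _ → refl) (f 0) (g 0))
  where
  term≈0 : ∀ y → Z ^ suc y * f (suc y) * g (suc y) ≈ 0#
  term≈0 y with one-vanishes y
  ... | inj₁ f≈0 = ≈-trans (*-cong (*-cong ≈-refl f≈0) ≈-refl)
                    (solve 2 (λ p b → p :* con (+ 0) :* b := con (+ 0)) (λ _ → refl) (Z ^ suc y) (g (suc y)))
  ... | inj₂ g≈0 = *-zeroʳ-≈ (Z ^ suc y * f (suc y)) g≈0

-- A solution of the homogeneous equation

rec₄ : (ℕ → Series) → ℕ → Series
rec₄ v k = v (2 ℕ.+ k) - v (3 ℕ.+ k) - Z * v (1 ℕ.+ k) - Z ^ 2 * v k

module _ (w : ℕ) where

  -- The combination of α and β that vanishes at 0, 1 and w + 3.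
  v : ℕ → Series
  v k = sign w * (β (3 ℕ.+ w) * α k - α (3 ℕ.+ w) * β k)

  v-rec : ∀ k → v (4 ℕ.+ k) ≈ rec₄ v k
  v-rec k = solve 12 (λ s a b z a₀ a₁ a₂ a₃ b₀ b₁ b₂ b₃ →
      let next = λ x₀ x₁ x₂ x₃ → x₂ :- x₃ :- z :* x₁ :- z :^ 2 :* x₀
          comb = λ x y → s :* (b :* x :- a :* y)
      in comb (next a₀ a₁ a₂ a₃) (next b₀ b₁ b₂ b₃)
           := comb a₂ b₂ :- comb a₃ b₃ :- z :* comb a₁ b₁ :- z :^ 2 :* comb a₀ b₀)
    (λ _ → refl) (sign w) (α (3 ℕ.+ w)) (β (3 ℕ.+ w)) Z
    (α k) (α (1 ℕ.+ k)) (α (2 ℕ.+ k)) (α (3 ℕ.+ k)) (β k) (β (1 ℕ.+ k)) (β (2 ℕ.+ k)) (β (3 ℕ.+ k))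

  v-small : ∀ k → k ℕ.≤ 1 → v k ≈ 0#
  v-small 0 _ = solve 3 (λ s a b → s :* (b :* con (+ 0) :- a :* con (+ 0)) := con (+ 0)) (λ _ → refl)
                  (sign w) (α (3 ℕ.+ w)) (β (3 ℕ.+ w))
  v-small 1 _ = solve 3 (λ s a b → s :* (b :* con (+ 0) :- a :* con (+ 0)) := con (+ 0)) (λ _ → refl)
                  (sign w) (α (3 ℕ.+ w)) (β (3 ℕ.+ w))
  v-small (suc (suc k)) (s≤s ())

  v-top : v (3 ℕ.+ w) ≈ 0#
  v-top = solve 3 (λ s a b → s :* (b :* a :- a :* b) := con (+ 0)) (λ _ → refl)
            (sign w) (α (3 ℕ.+ w)) (β (3 ℕ.+ w))

  v≈D : v (2 ℕ.+ w) ≈ D w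
  v≈D = solve 5 (λ s a₂ a₃ b₂ b₃ → s :* (b₃ :* a₂ :- a₃ :* b₂) := s :* (a₂ :* b₃ :- a₃ :* b₂)) (λ _ → refl)
          (sign w) (α (2 ℕ.+ w)) (α (3 ℕ.+ w)) (β (2 ℕ.+ w)) (β (3 ℕ.+ w))

  v≈D-suc : v (4 ℕ.+ w) ≈ D (suc w)
  v≈D-suc = solve 5 (λ s a₃ a₄ b₃ b₄ → s :* (b₃ :* a₄ :- a₃ :* b₄) := :- s :* (a₃ :* b₄ :- a₄ :* b₃))
              (λ _ → refl) (sign w) (α (3 ℕ.+ w)) (α (4 ℕ.+ w)) (β (3 ℕ.+ w)) (β (4 ℕ.+ w))

  -- v read backwards from height w + 2; it vanishes above w because v 0 = v 1 = 0.
  U : ℕ → Series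
  U y = v ((2 ℕ.+ w) ℕ.∸ y)

  U-vanishes : VanishesAbove w U
  U-vanishes y w<y = v-small _ (begin
    (2 ℕ.+ w) ℕ.∸ y       ≤⟨ ℕP.∸-monoʳ-≤ (2 ℕ.+ w) w<y ⟩
    (2 ℕ.+ w) ℕ.∸ suc w   ≡⟨ ℕP.m+n∸n≡m 1 w ⟩
    1                     ∎)
    where open ℕP.≤-Reasoning

  private
    index : ∀ n {y} → y ℕ.≤ w → (n ℕ.+ w) ℕ.∸ y ≡ n ℕ.+ (w ℕ.∸ y)
    index n = ℕP.+-∸-assoc n

  prev-U : ∀ y → y ℕ.≤ w → prev U y ≈ v (3 ℕ.+ (w ℕ.∸ y))
  prev-U zero    _   = ≈-sym v-top
  prev-U (suc y) y<w = ≈-reflexive (cong v (index 3 y<w))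

  prev2-U : ∀ y → 1 ℕ.≤ y → y ℕ.≤ w → prev2 U y ≈ v (4 ℕ.+ (w ℕ.∸ y))
  prev2-U (suc zero)    _ 1≤w = ≈-sym (≈-trans (≈-reflexive (cong v (sym (index 4 1≤w)))) v-top)
  prev2-U (suc (suc y)) _ y≤w = ≈-reflexive (cong v (index 4 y≤w))

  transfer-U-zero : transfer U 0 ≈ D (suc w)
  transfer-U-zero = begin
    v (2 ℕ.+ w) - 0# - 0# - Z * v (1 ℕ.+ w) - Z ^ 2 * v w
      ≈⟨ solve 5 (λ a b c d z → a :- con (+ 0) :- con (+ 0) :- z :* b :- z :^ 2 :* c
                               := (a :- d :- z :* b :- z :^ 2 :* c) :+ d)
           (λ _ → refl) (v (2 ℕ.+ w)) (v (1 ℕ.+ w)) (v w) (v (3 ℕ.+ w)) Z ⟩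
    rec₄ v w + v (3 ℕ.+ w)
      ≈⟨ +-cong (≈-sym (v-rec w)) v-top ⟩
    v (4 ℕ.+ w) + 0#
      ≈⟨ +-cong v≈D-suc ≈-refl ⟩
    D (suc w) + 0#
      ≈⟨ solve 1 (λ a → a :+ con (+ 0) := a) (λ _ → refl) (D (suc w)) ⟩
    D (suc w) ∎
    where open ≈-Reasoning

  transfer-U-suc : ∀ y → suc y ℕ.≤ w → transfer U (suc y) ≈ 0#
  transfer-U-suc y y<w = begin
    U (suc y) - prev U (suc y) - prev2 U (suc y) - Z * U (2 ℕ.+ y) - Z ^ 2 * U (3 ℕ.+ y)
      ≈⟨ +-cong (+-cong (+-cong (+-cong (≈-reflexive (cong v (index 2 y<w)))
                                         (-‿cong (prev-U (suc y) y<w)))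
                                 (-‿cong (prev2-U (suc y) (s≤s ℕ.z≤n) y<w)))
                         (-‿cong (*-cong ≈-refl (≈-reflexive (cong v (index 1 y<w))))))
                 ≈-refl ⟩
    v (2 ℕ.+ k) - v (3 ℕ.+ k) - v (4 ℕ.+ k) - Z * v (1 ℕ.+ k) - Z ^ 2 * v k
      ≈⟨ solve 5 (λ a b c d e → a :- b :- c :- d :- e := (a :- b :- d :- e) :- c) (λ _ → refl)
           (v (2 ℕ.+ k)) (v (3 ℕ.+ k)) (v (4 ℕ.+ k)) (Z * v (1 ℕ.+ k)) (Z ^ 2 * v k) ⟩
    rec₄ v k - v (4 ℕ.+ k)
      ≈⟨ +-cong (≈-sym (v-rec k)) ≈-refl ⟩
    v (4 ℕ.+ k) - v (4 ℕ.+ k)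
      ≈⟨ solve 1 (λ a → a :- a := con (+ 0)) (λ _ → refl) (v (4 ℕ.+ k)) ⟩
    0# ∎
    where
    open ≈-Reasoning
    k : ℕ
    k = w ℕ.∸ suc y

-- Counting walks

count : (List Step → Bool) → List (List Step) → ℕ
count p xs = length (filter (λ ss → T? (p ss)) xs)

count-++ : ∀ p xs ys → count p (xs ++ ys) ≡ count p xs ℕ.+ count p ys
count-++ p xs ys = trans (cong length (filter-++ (λ ss → T? (p ss)) xs ys)) (length-++ (filter _ xs))

count-map-∷ : ∀ p s xs → count p (map (s ∷_) xs) ≡ count (λ ss → p (s ∷ ss)) xs
count-map-∷ p s []       = refl
count-map-∷ p s (x ∷ xs) with p (s ∷ x)
... | true  = cong suc (count-map-∷ p s xs)
... | false = count-map-∷ p s xs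

count-∧ : ∀ b q xs → count (λ ss → b ∧ q ss) xs ≡ (if b then count q xs else 0)
count-∧ true  q xs = refl
count-∧ false q []       = refl
count-∧ false q (x ∷ xs) = count-∧ false q xs

inStrip : ℕ → ℤ → Bool
inStrip w h = ⌊ + 0 ℤ.≤? h ⌋ ∧ ⌊ h ℤ.≤? + w ⌋

walksFrom : ℕ → ℤ → ℕ → ℕ
walksFrom w h L = count (valid w h) (stepSeqs L)

walksIn : ℕ → ℤ → ℕ → ℕ
walksIn w h L = if inStrip w h then walksFrom w h L else 0

count-step : ∀ w h s xs →
  count (valid w h) (map (s ∷_) xs) ≡ (if inStrip w (h ℤ.+ dy s) then count (valid w (h ℤ.+ dy s)) xs else 0)
count-step w h s xs = begin
  count (valid w h) (map (s ∷_) xs)                                   ≡⟨ count-map-∷ (valid w h) s xs ⟩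
  count (λ ss → ⌊ + 0 ℤ.≤? h′ ⌋ ∧ (⌊ h′ ℤ.≤? + w ⌋ ∧ valid w h′ ss)) xs ≡⟨ count-∧ _ _ xs ⟩
  (if ⌊ + 0 ℤ.≤? h′ ⌋ then count (λ ss → ⌊ h′ ℤ.≤? + w ⌋ ∧ valid w h′ ss) xs else 0)
    ≡⟨ gates ⌊ + 0 ℤ.≤? h′ ⌋ ⌊ h′ ℤ.≤? + w ⌋ ⟩
  (if inStrip w h′ then count (valid w h′) xs else 0)                 ∎
  where
  open ≡-Reasoning
  h′ : ℤ
  h′ = h ℤ.+ dy s
  gates : ∀ b₁ b₂ → (if b₁ then count (λ ss → b₂ ∧ valid w h′ ss) xs else 0)
                  ≡ (if b₁ ∧ b₂ then count (valid w h′) xs else 0)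
  gates false b₂ = refl
  gates true  b₂ = count-∧ b₂ (valid w h′) xs

twoSteps : ℕ → ℤ → ℕ → ℕ
twoSteps w h zero    = 0
twoSteps w h (suc L) = walksIn w (h ℤ.+ dy u2) L ℕ.+ walksIn w (h ℤ.+ dy d2) L

walksFrom-suc : ∀ w h L →
  walksFrom w h (suc L) ≡ walksIn w (h ℤ.+ dy u1) L ℕ.+ (walksIn w (h ℤ.+ dy d1) L ℕ.+ twoSteps w h L)
walksFrom-suc w h zero = begin
  count (valid w h) (map (u1 ∷_) S ++ map (d1 ∷_) S)
    ≡⟨ count-++ (valid w h) (map (u1 ∷_) S) (map (d1 ∷_) S) ⟩
  count (valid w h) (map (u1 ∷_) S) ℕ.+ count (valid w h) (map (d1 ∷_) S)
    ≡⟨ cong₂ ℕ._+_ (count-step w h u1 S) (trans (count-step w h d1 S) (sym (ℕP.+-identityʳ _))) ⟩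
  walksIn w (h ℤ.+ dy u1) 0 ℕ.+ (walksIn w (h ℤ.+ dy d1) 0 ℕ.+ 0) ∎
  where
  open ≡-Reasoning
  S : List (List Step)
  S = stepSeqs zero
walksFrom-suc w h (suc L) = begin
  count (valid w h) (map (u1 ∷_) S₁ ++ map (d1 ∷_) S₁ ++ map (u2 ∷_) S₀ ++ map (d2 ∷_) S₀)
    ≡⟨ count-++ (valid w h) (map (u1 ∷_) S₁) _ ⟩
  count (valid w h) (map (u1 ∷_) S₁) ℕ.+ count (valid w h) (map (d1 ∷_) S₁ ++ map (u2 ∷_) S₀ ++ map (d2 ∷_) S₀)
    ≡⟨ cong₂ ℕ._+_ (count-step w h u1 S₁) (trans (count-++ (valid w h) (map (d1 ∷_) S₁) _)
         (cong₂ ℕ._+_ (count-step w h d1 S₁) (trans (count-++ (valid w h) (map (u2 ∷_) S₀) _)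
           (cong₂ ℕ._+_ (count-step w h u2 S₀) (count-step w h d2 S₀))))) ⟩
  walksIn w (h ℤ.+ dy u1) (suc L) ℕ.+ (walksIn w (h ℤ.+ dy d1) (suc L) ℕ.+ twoSteps w h (suc L)) ∎
  where
  open ≡-Reasoning
  S₀ S₁ : List (List Step)
  S₀ = stepSeqs L
  S₁ = stepSeqs (suc L)

walksIn-≡0 : ∀ w h L → walksFrom w h L ≡ 0 → walksIn w h L ≡ 0
walksIn-≡0 w h L e with inStrip w h
... | true  = e
... | false = refl

walksIn-short : ∀ w y L → L ℕ.< y → walksIn w (+ y) L ≡ 0
walksIn-short w y L L<y = walksIn-≡0 w (+ y) L (short y L L<y)
  where
  short : ∀ y L → L ℕ.< y → walksFrom w (+ y) L ≡ 0
  short (suc y) zero    _           = refl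
  short (suc y) (suc L) (s≤s L<y) = begin
    walksFrom w (+ suc y) (suc L)                                 ≡⟨ walksFrom-suc w (+ suc y) L ⟩
    walksIn w (+ (suc y ℕ.+ 1)) L ℕ.+ (walksIn w (+ y) L ℕ.+ twoSteps w (+ suc y) L)
      ≡⟨ cong₂ ℕ._+_ (walksIn-short w (suc y ℕ.+ 1) L (ℕP.≤-trans (ℕP.m<n⇒m<1+n L<y) (ℕP.m≤m+n (suc y) 1)))
                     (cong₂ ℕ._+_ (walksIn-short w y L L<y) (two y L L<y)) ⟩
    0 ∎
    where
    open ≡-Reasoning
    two : ∀ y L → suc L ℕ.≤ y → twoSteps w (+ suc y) L ≡ 0
    two y zero _ = refl
    two (suc y) (suc L) (s≤s L<y) =
      cong₂ ℕ._+_ (walksIn-short w (suc (suc y) ℕ.+ 2) L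
                    (ℕP.≤-trans (ℕP.m<n⇒m<1+n (ℕP.m<n⇒m<1+n L<y)) (ℕP.m≤m+n (suc (suc y)) 2)))
                  (walksIn-short w y L L<y)

+-suc-suc : ∀ m n → m ℕ.+ suc (suc n) ≡ suc (suc (m ℕ.+ n))
+-suc-suc m n = trans (ℕP.+-suc m (suc n)) (cong suc (ℕP.+-suc m n))

twice : ℕ → ℕ
twice zero    = 0
twice (suc n) = suc (suc (twice n))

⌊⌋-true : ∀ {A : Set} (d : Dec A) → A → ⌊ d ⌋ ≡ true
⌊⌋-true d a = trans (isYes≗does d) (dec-true d a)

⌊⌋-false : ∀ {A : Set} (d : Dec A) → ¬ A → ⌊ d ⌋ ≡ false
⌊⌋-false d ¬a = trans (isYes≗does d) (dec-false d ¬a)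

in-strip : ∀ {w y} → y ℕ.≤ w → inStrip w (+ y) ≡ true
in-strip {w} {y} y≤w = cong₂ _∧_ (⌊⌋-true (+ 0 ℤ.≤? + y) (ℤ.+≤+ ℕ.z≤n)) (⌊⌋-true (+ y ℤ.≤? + w) (ℤ.+≤+ y≤w))

above-strip : ∀ {w y} → w ℕ.< y → inStrip w (+ y) ≡ false
above-strip {w} {y} w<y = cong₂ _∧_ (⌊⌋-true (+ 0 ℤ.≤? + y) (ℤ.+≤+ ℕ.z≤n))
                                    (⌊⌋-false (+ y ℤ.≤? + w) (λ { (ℤ.+≤+ y≤w) → ℕP.<⇒≱ w<y y≤w }))

Z²*-as-Z*Z* : ∀ f → Z ^ 2 * f ≈ Z * (Z * f)
Z²*-as-Z*Z* f = solve 2 (λ z a → z :^ 2 :* a := z :* (z :* a)) (λ _ → refl) Z f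

δ : ℕ → Series
δ zero    = 1#
δ (suc _) = 0#

module _ (w : ℕ) where

  K : ℕ → Series
  K y n = + walksIn w (+ y) (twice n ℕ.+ y)

  K-vanishes : VanishesAbove w K
  K-vanishes y w<y n = trans (cong (λ b → + (if b then walksFrom w (+ y) (twice n ℕ.+ y) else 0)) (above-strip w<y))
                             (sym (0#-≡ n))

  K-in-strip : ∀ {y} → y ℕ.≤ w → ∀ n → K y n ≡ + walksFrom w (+ y) (twice n ℕ.+ y)
  K-in-strip {y} y≤w n = cong (λ b → + (if b then walksFrom w (+ y) (twice n ℕ.+ y) else 0)) (in-strip y≤w)

  F≈K : F w ≈ K 0
  F≈K n = sym (trans (K-in-strip ℕ.z≤n n) (cong (λ L → + walksFrom w (+ 0) L) (twice≡2* n)))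
    where
    twice≡2* : ∀ n → twice n ℕ.+ 0 ≡ 2 ℕ.* n
    twice≡2* zero    = refl
    twice≡2* (suc n) = trans (cong (λ m → suc (suc m)) (twice≡2* n)) (sym (ℕP.*-suc 2 n))

  -- The four kinds of first step, matched with the terms of transfer K.
  up-one : ∀ y n L → suc L ≡ twice n ℕ.+ y → + walksIn w (+ y ℤ.+ dy u1) L ≡ (Z * K (suc y)) n
  up-one y zero    L refl = trans (cong +_ (walksIn-short w (y ℕ.+ 1) L L<y+1)) (sym (Z*-zero (K (suc y))))
    where
    L<y+1 : L ℕ.< y ℕ.+ 1
    L<y+1 = ℕP.m≤n⇒m≤n+o 1 ℕP.≤-refl
  up-one y (suc n) L eq = sym (trans (Z*-suc (K (suc y)) n)
    (cong₂ (λ h L′ → + walksIn w h L′) (cong +_ (ℕP.+-comm 1 y))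
           (trans (ℕP.+-suc (twice n) y) (sym (ℕP.suc-injective eq)))))

  down-one : ∀ y n L → suc L ≡ twice n ℕ.+ y → + walksIn w (+ y ℤ.+ dy d1) L ≡ prev K y n
  down-one zero    n L eq = sym (0#-≡ n)
  down-one (suc y) n L eq =
    cong (λ L′ → + walksIn w (+ y) L′) (ℕP.suc-injective (trans eq (ℕP.+-suc (twice n) y)))

  up-two : ∀ y n L → suc (suc L) ≡ twice n ℕ.+ y → + walksIn w (+ y ℤ.+ dy u2) L ≡ (Z ^ 2 * K (2 ℕ.+ y)) n
  up-two y zero L refl =
    trans (cong +_ (walksIn-short w (suc (suc L) ℕ.+ 2) L (ℕP.m≤n⇒m≤n+o 2 (ℕP.n≤1+n (suc L)))))
          (sym (trans (Z²*-as-Z*Z* (K (2 ℕ.+ y)) 0) (Z*-zero (Z * K (2 ℕ.+ y)))))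
  up-two y (suc zero) L eq =
    trans (cong +_ (walksIn-short w (y ℕ.+ 2) L (subst (λ m → L ℕ.< m ℕ.+ 2) L≡y (ℕP.m<m+n L (s≤s ℕ.z≤n)))))
          (sym (trans (Z²*-as-Z*Z* (K (2 ℕ.+ y)) 1) (trans (Z*-suc (Z * K (2 ℕ.+ y)) 0) (Z*-zero (K (2 ℕ.+ y))))))
    where
    L≡y : L ≡ y
    L≡y = ℕP.suc-injective (ℕP.suc-injective eq)
  up-two y (suc (suc n)) L eq = sym (begin
    (Z ^ 2 * K (2 ℕ.+ y)) (2 ℕ.+ n)  ≡⟨ Z²*-as-Z*Z* (K (2 ℕ.+ y)) (2 ℕ.+ n) ⟩
    (Z * (Z * K (2 ℕ.+ y))) (2 ℕ.+ n) ≡⟨ trans (Z*-suc (Z * K (2 ℕ.+ y)) (suc n)) (Z*-suc (K (2 ℕ.+ y)) n) ⟩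
    K (2 ℕ.+ y) n                     ≡⟨ cong₂ (λ h L′ → + walksIn w h L′) (cong +_ (ℕP.+-comm 2 y)) L-eq ⟩
    + walksIn w (+ y ℤ.+ dy u2) L     ∎)
    where
    open ≡-Reasoning
    L-eq : twice n ℕ.+ (2 ℕ.+ y) ≡ L
    L-eq = trans (+-suc-suc (twice n) y) (sym (ℕP.suc-injective (ℕP.suc-injective eq)))

  down-two : ∀ y n L → suc (suc L) ≡ twice n ℕ.+ y → + walksIn w (+ y ℤ.+ dy d2) L ≡ prev2 K y n
  down-two zero          n L eq = sym (0#-≡ n)
  down-two (suc zero)    n L eq = sym (0#-≡ n)
  down-two (suc (suc y)) n L eq = cong (λ L′ → + walksIn w (+ y) L′)
    (ℕP.suc-injective (ℕP.suc-injective (trans eq (+-suc-suc (twice n) y))))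

  two-steps : ∀ y n L → suc L ≡ twice n ℕ.+ y →
    + twoSteps w (+ y) L ≡ (Z ^ 2 * K (2 ℕ.+ y)) n ℤ.+ prev2 K y n
  two-steps (suc zero) zero    zero    refl = sym (cong (ℤ._+ + 0) (trans (Z²*-as-Z*Z* (K 3) 0) (Z*-zero (Z * K 3))))
  two-steps y          n       (suc L) eq   = cong₂ ℤ._+_ (up-two y n L eq) (down-two y n L eq)
  two-steps zero       zero    zero    ()
  two-steps (suc (suc y)) zero zero    ()
  two-steps y          (suc n) zero    ()

  δ-vanishes : ∀ y n L → suc L ≡ twice n ℕ.+ y → δ y n ≡ + 0
  δ-vanishes zero    (suc n) L eq = refl
  δ-vanishes (suc y) n       L eq = 0#-≡ n

  transfer-K-coeff : ∀ y n L → y ℕ.≤ w → suc L ≡ twice n ℕ.+ y → transfer K y n ≡ δ y n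
  transfer-K-coeff y n L y≤w eq = begin
    K y n ℤ.- p ℤ.- p₂ ℤ.- zk ℤ.- z²k                       ≡⟨ cong (λ k → k ℤ.- p ℤ.- p₂ ℤ.- zk ℤ.- z²k) K-split ⟩
    zk ℤ.+ (p ℤ.+ (z²k ℤ.+ p₂)) ℤ.- p ℤ.- p₂ ℤ.- zk ℤ.- z²k ≡⟨ cancel zk p z²k p₂ ⟩
    + 0                                                     ≡⟨ sym (δ-vanishes y n L eq) ⟩
    δ y n                                                   ∎
    where
    open ≡-Reasoning
    p p₂ zk z²k : ℤ
    p   = prev K y n
    p₂  = prev2 K y n
    zk  = (Z * K (suc y)) n
    z²k = (Z ^ 2 * K (2 ℕ.+ y)) n
    K-split : K y n ≡ zk ℤ.+ (p ℤ.+ (z²k ℤ.+ p₂))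
    K-split = begin
      K y n                                 ≡⟨ K-in-strip y≤w n ⟩
      + walksFrom w (+ y) (twice n ℕ.+ y)   ≡⟨ cong (λ L′ → + walksFrom w (+ y) L′) (sym eq) ⟩
      + walksFrom w (+ y) (suc L)           ≡⟨ cong +_ (walksFrom-suc w (+ y) L) ⟩
      + (walksIn w (+ y ℤ.+ dy u1) L ℕ.+ (walksIn w (+ y ℤ.+ dy d1) L ℕ.+ twoSteps w (+ y) L))
                                            ≡⟨ cong₂ ℤ._+_ (up-one y n L eq) (cong₂ ℤ._+_ (down-one y n L eq) (two-steps y n L eq)) ⟩
      zk ℤ.+ (p ℤ.+ (z²k ℤ.+ p₂))          ∎
    cancel : ∀ a b c d → a ℤ.+ (b ℤ.+ (c ℤ.+ d)) ℤ.- b ℤ.- d ℤ.- a ℤ.- c ≡ + 0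
    cancel = solve-∀

  transfer-K : ∀ y → y ℕ.≤ w → transfer K y ≈ δ y
  transfer-K zero    y≤w zero    = refl
  transfer-K zero    y≤w (suc n) = transfer-K-coeff zero (suc n) (suc (twice n ℕ.+ 0)) y≤w refl
  transfer-K (suc y) y≤w n       = transfer-K-coeff (suc y) n (twice n ℕ.+ y) y≤w (sym (ℕP.+-suc (twice n) y))

walk-identity : ∀ w → D (suc w) * K w 0 ≈ D w
walk-identity w = begin
  D (suc w) * K w 0                        ≈⟨ *-cong (≈-sym (transfer-U-zero w)) ≈-refl ⟩
  transfer (U w) 0 * K w 0                 ≈⟨ ≈-sym (pairing-head (2 ℕ.+ w) (transfer (U w)) (K w) U-side) ⟩
  pairing (3 ℕ.+ w) (transfer (U w)) (K w) ≈⟨ ≈-sym (transfer-symmetric w (U w) (K w) (U-vanishes w) (K-vanishes w)) ⟩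
  pairing (3 ℕ.+ w) (U w) (transfer (K w)) ≈⟨ pairing-head (2 ℕ.+ w) (U w) (transfer (K w)) K-side ⟩
  U w 0 * transfer (K w) 0                 ≈⟨ *-cong ≈-refl (transfer-K w 0 ℕ.z≤n) ⟩
  U w 0 * 1#                               ≈⟨ solve 1 (λ a → a :* con (+ 1) := a) (λ _ → refl) (U w 0) ⟩
  v w (2 ℕ.+ w)                            ≈⟨ v≈D w ⟩
  D w                                      ∎
  where
  open ≈-Reasoning
  U-side : ∀ y → transfer (U w) (suc y) ≈ 0# ⊎ K w (suc y) ≈ 0#
  U-side y with ℕP.≤-<-connex (suc y) w
  ... | inj₁ y<w = inj₁ (transfer-U-suc w y y<w)
  ... | inj₂ w<y = inj₂ (K-vanishes w (suc y) w<y)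
  K-side : ∀ y → U w (suc y) ≈ 0# ⊎ transfer (K w) (suc y) ≈ 0#
  K-side y with ℕP.≤-<-connex (suc y) w
  ... | inj₁ y<w = inj₂ (transfer-K w (suc y) y<w)
  ... | inj₂ w<y = inj₁ (U-vanishes w (suc y) w<y)

convAux-[] : ∀ f n k → convAux [] f n k ≡ + 0
convAux-[] f n zero    = refl
convAux-[] f n (suc k) = trans (ℤP.+-identityˡ _) (convAux-[] f n k)

convAux-∷ : ∀ a p f n k → convAux (a ∷ p) f (suc n) (suc k) ≡ a ℤ.* f (suc n) ℤ.+ convAux p f n k
convAux-∷ a p f n zero    = ℤP.+-comm (coeff p 0 ℤ.* f n) (a ℤ.* f (suc n))
convAux-∷ a p f n (suc k) = trans (cong (ℤ._+_ (coeff p (suc k) ℤ.* f (n ℕ.∸ suc k))) (convAux-∷ a p f n k))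
  (x∙yz≈y∙xz (coeff p (suc k) ℤ.* f (n ℕ.∸ suc k)) (a ℤ.* f (suc n)) (convAux p f n k))

mulCoeff-≡-* : ∀ p f n → mulCoeff p f n ≡ (coeff p * f) n
mulCoeff-≡-* []      f n       = trans (convAux-[] f n n) (sym (*-vanishˡ f (λ _ → refl) n))
mulCoeff-≡-* (a ∷ p) f zero    = refl
mulCoeff-≡-* (a ∷ p) f (suc n) = trans (convAux-∷ a p f n n) (cong (ℤ._+_ (a ℤ.* f (suc n))) (mulCoeff-≡-* p f n))

theorem3 : ∀ (w n : ℕ) → mulCoeff (Q w) (F w) n ≡ coeff (P w) n
theorem3 w n = begin
  mulCoeff (Q w) (F w) n   ≡⟨ mulCoeff-≡-* (Q w) (F w) n ⟩
  (coeff (Q w) * F w) n    ≡⟨ *-cong (Q≈D w) (F≈K w) n ⟩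
  (D (suc w) * K w 0) n    ≡⟨ walk-identity w n ⟩
  D w n                    ≡⟨ sym (P≈D w n) ⟩
  coeff (P w) n            ∎
  where open ≡-Reasoning
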